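{- Let $n,k$ be positive integers with $n\ge k$. Then $\mathrm{JS}_n^k(z)$ and $(-1)^{n-k}\mathrm{js}_n^k(z)$ are polynomials in $z$ of degree $n-k$ with positive integer coefficients. Moreover, writing $$\mathrm{JS}_n^k(z)=a_{n,k}^{(0)}+a_{n,k}^{(1)}z+\cdots+a_{n,k}^{(n-k)}z^{n-k},\qquad (-1)^{n-k}\mathrm{js}_n^k(z)=b_{n,k}^{(0)}+b_{n,k}^{(1)}z+\cdots+b_{n,k}^{(n-k)}z^{n-k},$$ we have $a_{n,k}^{(n-k)}=S(n,k)$, $a_{n,k}^{(0)}=U(n,k)$, $b_{n,k}^{(n-k)}=|s(n,k)|$ and $b_{n,k}^{(0)}=|u(n,k)|$.
   Context: For an indeterminate $z$, the Jacobi–Stirling numbers of the second kind $\mathrm{JS}_n^k(z)$ and of the first kind $\mathrm{js}_n^k(z)$ ($0\le k\le n$) are defined by $$x^n=\sum_{k=0}^n \mathrm{JS}_n^k(z)\prod_{i=0}^{k-1}\bigl(x-i(z+i)\bigr),\qquad \prod_{i=0}^{n-1}\bigl(x-i(z+i)\bigr)=\sum_{k=0}^n \mathrm{js}_n^k(z)x^k .$$ Equivalently, $\mathrm{JS}_0^0=\mathrm{js}_0^0=1$, both vanish for $n\ge1$ and $k\notin\{1,\dots,n\}$, and for $n,k\ge1$: $\mathrm{JS}_n^k(z)=\mathrm{JS}_{n-1}^{k-1}(z)+k(k+z)\mathrm{JS}_{n-1}^k(z)$, $\mathrm{js}_n^k(z)=\mathrm{js}_{n-1}^{k-1}(z)-(n-1)(n-1+z)\mathrm{js}_{n-1}^k(z)$.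 $S(n,k)$ and $s(n,k)$ are the Stirling numbers of the second and first kind: $x^n=\sum_k S(n,k)\prod_{i=0}^{k-1}(x-i)$ and $\prod_{i=0}^{n-1}(x-i)=\sum_k s(n,k)x^k$. The central factorial numbers of even indices $U(n,k)$ and $u(n,k)$ are defined by $x^n=\sum_{k=0}^n U(n,k)\prod_{i=0}^{k-1}(x-i^2)$ and $\prod_{i=0}^{n-1}(x-i^2)=\sum_{k=0}^n u(n,k)x^k$ (so $U(n,k)=U(n-1,k-1)+k^2U(n-1,k)$ and $u(n,k)=u(n-1,k-1)-(n-1)^2u(n-1,k)$). -}

module Defs where

open import Data.Nat using (ℕ; zero; suc)
open import Data.Integer using (ℤ; +_; -_; _+_; _*_)
open import Data.List using (List; []; _∷_; map)

-- Polynomials in z with integer coefficients, as coefficient lists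
-- (head = constant term).
Poly : Set
Poly = List ℤ

infixl 6 _⊕_
_⊕_ : Poly → Poly → Poly
[]      ⊕ q       = q
(a ∷ p) ⊕ []      = a ∷ p
(a ∷ p) ⊕ (b ∷ q) = (a + b) ∷ (p ⊕ q)

scale : ℤ → Poly → Poly
scale c p = map (c *_) p

infixl 7 _⊛_
_⊛_ : Poly → Poly → Poly
[]      ⊛ q = []
(a ∷ p) ⊛ q = scale a q ⊕ (+ 0 ∷ (p ⊛ q))

coeff : Poly → ℕ → ℤ
coeff []      _       = + 0
coeff (a ∷ p) zero    = a
coeff (a ∷ p) (suc i) = coeff p i

JS : ℕ → ℕ → Poly
JS zero    zero    = + 1 ∷ []
JS zero    (suc k) = []
JS (suc n) zero    = []
JS (suc n) (suc k) =
  JS n k ⊕ ((+ (suc k Data.Nat.* suc k) ∷ + suc k ∷ []) ⊛ JS n (suc k))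

js : ℕ → ℕ → Poly
js zero    zero    = + 1 ∷ []
js zero    (suc k) = []
js (suc n) zero    = []
js (suc n) (suc k) =
  js n k ⊕ ((- (+ (n Data.Nat.* n)) ∷ - (+ n) ∷ []) ⊛ js n (suc k))

S : ℕ → ℕ → ℤ
S zero    zero    = + 1
S zero    (suc k) = + 0
S (suc n) zero    = + 0
S (suc n) (suc k) = S n k + + suc k * S n (suc k)

s : ℕ → ℕ → ℤ
s zero    zero    = + 1
s zero    (suc k) = + 0
s (suc n) zero    = + 0
s (suc n) (suc k) = s n k + - (+ n) * s n (suc k)

U : ℕ → ℕ → ℤ
U zero    zero    = + 1
U zero    (suc k) = + 0
U (suc n) zero    = + 0
U (suc n) (suc k) = U n k + + (suc k Data.Nat.* suc k) * U n (suc k)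

u : ℕ → ℕ → ℤ
u zero    zero    = + 1
u zero    (suc k) = + 0
u (suc n) zero    = + 0
u (suc n) (suc k) = u n k + - (+ (n Data.Nat.* n)) * u n (suc k)

-- Both JS_n^k and (-1)^(n+k) js_n^k satisfy P_{n+1}^{k+1} = P_n^k + (α(n,k) + β(n,k) z) P_n^{k+1}
-- with natural weights: α = (k+1)², β = k+1 for JS and α = n², β = n for js. Their coefficients
-- thus form a triangle of natural numbers that vanishes above degree n-k, whose top coefficient
-- follows the recurrence with β alone (S and |s|) and whose constant coefficient follows the one
-- with α alone (U and |u|); all coefficients up to degree n-k are positive because both weights
-- are positive at k = 0, n ≥ 1. Finally (-1)^(n+k) = (-1)^(n-k).
module Submission where

open import Defs
open import Data.Nat using (ℕ; _≤_; _<_; _∸_)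
open import Data.Integer using (ℤ; +_; -_; _^_; ∣_∣) renaming (_<_ to _<ℤ_)
open import Data.Product using (_×_)
open import Relation.Binary.PropositionalEquality using (_≡_)

open import Data.Nat as ℕ using (zero; suc; z≤n; s≤s)
import Data.Nat.Properties as ℕ
open import Data.Integer using (_+_; _*_; -1ℤ; 1ℤ; +<+)
import Data.Integer.Properties as ℤ
open import Data.Integer.Solver using (module +-*-Solver)
open import Data.Product using (_,_)
open import Data.List using ([]; _∷_)
open import Relation.Binary.PropositionalEquality
  using (refl; sym; trans; cong; cong₂; subst; module ≡-Reasoning)

triangle : (ℕ → ℕ → ℕ) → ℕ → ℕ → ℕ
triangle γ zero    zero    = 1
triangle γ zero    (suc k) = 0
triangle γ (suc n) zero    = 0
triangle γ (suc n) (suc k) = triangle γ n k ℕ.+ γ n k ℕ.* triangle γ n (suc k)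

triangle-vanishes : ∀ γ {n k} → n < k → triangle γ n k ≡ 0
triangle-vanishes γ {zero}  {suc k} _ = refl
triangle-vanishes γ {suc n} {suc k} (s≤s n<k)
  rewrite triangle-vanishes γ n<k | triangle-vanishes γ (ℕ.m<n⇒m<1+n n<k)
  = ℕ.*-zeroʳ (γ n k)

module LinearTriangle (α β : ℕ → ℕ → ℕ) where

  coef : ℕ → ℕ → ℕ → ℕ
  coef zero    zero    zero    = 1
  coef zero    zero    (suc i) = 0
  coef zero    (suc k) i       = 0
  coef (suc n) zero    i       = 0
  coef (suc n) (suc k) zero    = coef n k zero ℕ.+ α n k ℕ.* coef n (suc k) zero
  coef (suc n) (suc k) (suc i) =
    coef n k (suc i) ℕ.+ (α n k ℕ.* coef n (suc k) (suc i) ℕ.+ β n k ℕ.* coef n (suc k) i)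

  coef-vanishes : ∀ {n} k i → n < k ℕ.+ i → coef n k i ≡ 0
  coef-vanishes {zero}  zero    (suc i) _ = refl
  coef-vanishes {zero}  (suc k) i       _ = refl
  coef-vanishes {suc n} zero    i       _ = refl
  coef-vanishes {suc n} (suc k) zero    (s≤s n<k+0)
    rewrite coef-vanishes k zero n<k+0 | coef-vanishes (suc k) zero (ℕ.m<n⇒m<1+n n<k+0)
    = ℕ.*-zeroʳ (α n k)
  coef-vanishes {suc n} (suc k) (suc i) (s≤s n<k+1+i)
    rewrite coef-vanishes k (suc i) n<k+1+i
          | coef-vanishes (suc k) (suc i) (ℕ.m<n⇒m<1+n n<k+1+i)
          | coef-vanishes (suc k) i (subst (n <_) (ℕ.+-suc k i) n<k+1+i)
          | ℕ.*-zeroʳ (α n k) | ℕ.*-zeroʳ (β n k)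
    = refl

  coef-leading : ∀ {n} k i → k ℕ.+ i ≡ n → coef n k i ≡ triangle β n k
  coef-leading zero    zero    refl = refl
  coef-leading zero    (suc i) refl = refl
  coef-leading (suc k) zero    refl
    rewrite coef-leading k zero refl
          | coef-vanishes (suc k) zero (ℕ.n<1+n (k ℕ.+ 0))
          | triangle-vanishes β (s≤s (ℕ.≤-reflexive (ℕ.+-identityʳ k)))
          | ℕ.*-zeroʳ (α (k ℕ.+ 0) k) | ℕ.*-zeroʳ (β (k ℕ.+ 0) k)
    = refl
  coef-leading (suc k) (suc i) refl
    rewrite coef-leading k (suc i) refl
          | coef-vanishes (suc k) (suc i) (ℕ.n<1+n (k ℕ.+ suc i))
          | coef-leading (suc k) i (sym (ℕ.+-suc k i))
          | ℕ.*-zeroʳ (α (k ℕ.+ suc i) k)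
    = refl

  coef-constant : ∀ n k → coef n k 0 ≡ triangle α n k
  coef-constant zero    zero    = refl
  coef-constant zero    (suc k) = refl
  coef-constant (suc n) zero    = refl
  coef-constant (suc n) (suc k) rewrite coef-constant n k | coef-constant n (suc k) = refl

  coef-≤-coef-suc : ∀ n k i → coef n k i ≤ coef (suc n) (suc k) i
  coef-≤-coef-suc n k zero    = ℕ.m≤m+n _ _
  coef-≤-coef-suc n k (suc i) = ℕ.m≤m+n _ _

  coef-positive : (∀ m → 0 < α (suc m) 0) → (∀ m → 0 < β (suc m) 0) →
                  ∀ {n} k i → 1 ≤ k → k ℕ.+ i ≤ n → 0 < coef n k i
  coef-positive α>0 β>0 {suc n} (suc (suc k)) i _ (s≤s k+i<n) =
    ℕ.<-≤-trans (coef-positive α>0 β>0 (suc k) i (s≤s z≤n) k+i<n) (coef-≤-coef-suc n (suc k) i)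
  coef-positive α>0 β>0 {suc zero}    (suc zero) zero    _ _ = s≤s z≤n
  coef-positive α>0 β>0 {suc zero}    (suc zero) (suc i) _ (s≤s ())
  coef-positive α>0 β>0 {suc (suc m)} (suc zero) zero    _ _ =
    ℕ.*-mono-< (α>0 m) (coef-positive α>0 β>0 1 0 (s≤s z≤n) (s≤s z≤n))
  coef-positive α>0 β>0 {suc (suc m)} (suc zero) (suc i) _ (s≤s 1+i≤1+m) =
    ℕ.<-≤-trans (ℕ.*-mono-< (β>0 m) (coef-positive α>0 β>0 1 i (s≤s z≤n) 1+i≤1+m))
                (ℕ.m≤n+m _ _)

coeff-⊕ : ∀ p q i → coeff (p ⊕ q) i ≡ coeff p i + coeff q i
coeff-⊕ []      q       i       = sym (ℤ.+-identityˡ _)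
coeff-⊕ (a ∷ p) []      i       = sym (ℤ.+-identityʳ _)
coeff-⊕ (a ∷ p) (b ∷ q) zero    = refl
coeff-⊕ (a ∷ p) (b ∷ q) (suc i) = coeff-⊕ p q i

coeff-scale : ∀ c p i → coeff (scale c p) i ≡ c * coeff p i
coeff-scale c []      i       = sym (ℤ.*-zeroʳ c)
coeff-scale c (a ∷ p) zero    = refl
coeff-scale c (a ∷ p) (suc i) = coeff-scale c p i

coeff-zero : ∀ i → coeff (+ 0 ∷ []) i ≡ + 0
coeff-zero zero    = refl
coeff-zero (suc i) = refl

coeff-step-zero : ∀ p x y q → coeff (p ⊕ (x ∷ y ∷ []) ⊛ q) 0 ≡ coeff p 0 + x * coeff q 0
coeff-step-zero p x y q
  rewrite coeff-⊕ p ((x ∷ y ∷ []) ⊛ q) 0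
        | coeff-⊕ (scale x q) (+ 0 ∷ (scale y q ⊕ (+ 0 ∷ []))) 0
        | coeff-scale x q 0
  = cong (λ t → coeff p 0 + t) (ℤ.+-identityʳ _)

coeff-step-suc : ∀ p x y q i → coeff (p ⊕ (x ∷ y ∷ []) ⊛ q) (suc i)
                               ≡ coeff p (suc i) + (x * coeff q (suc i) + y * coeff q i)
coeff-step-suc p x y q i
  rewrite coeff-⊕ p ((x ∷ y ∷ []) ⊛ q) (suc i)
        | coeff-⊕ (scale x q) (+ 0 ∷ (scale y q ⊕ (+ 0 ∷ []))) (suc i)
        | coeff-scale x q (suc i)
        | coeff-⊕ (scale y q) (+ 0 ∷ []) i
        | coeff-scale y q i | coeff-zero i
        | ℤ.+-identityʳ (y * coeff q i)
  = refl

pos-+-* : ∀ a x b → + (a ℕ.+ x ℕ.* b) ≡ + a + + x * + b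
pos-+-* a x b = trans (ℤ.pos-+ a (x ℕ.* b)) (cong (λ t → + a + t) (ℤ.pos-* x b))

pos-+-*-+-* : ∀ a x b y c →
  + (a ℕ.+ (x ℕ.* b ℕ.+ y ℕ.* c)) ≡ + a + (+ x * + b + + y * + c)
pos-+-*-+-* a x b y c =
  trans (ℤ.pos-+ a (x ℕ.* b ℕ.+ y ℕ.* c))
        (cong (λ t → + a + t) (trans (ℤ.pos-+ (x ℕ.* b) (y ℕ.* c)) (cong₂ _+_ (ℤ.pos-* x b) (ℤ.pos-* y c))))

S-weight U-weight s-weight u-weight : ℕ → ℕ → ℕ
S-weight _ k = suc k
U-weight _ k = suc k ℕ.* suc k
s-weight n _ = n
u-weight n _ = n ℕ.* n

module JSCoef = LinearTriangle U-weight S-weight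

coeff-JS : ∀ n k i → coeff (JS n k) i ≡ + JSCoef.coef n k i
coeff-JS zero    zero    zero    = refl
coeff-JS zero    zero    (suc i) = refl
coeff-JS zero    (suc k) i       = refl
coeff-JS (suc n) zero    i       = refl
coeff-JS (suc n) (suc k) zero
  rewrite coeff-step-zero (JS n k) (+ (suc k ℕ.* suc k)) (+ suc k) (JS n (suc k))
        | coeff-JS n k 0 | coeff-JS n (suc k) 0
  = sym (pos-+-* (JSCoef.coef n k 0) (suc k ℕ.* suc k) (JSCoef.coef n (suc k) 0))
coeff-JS (suc n) (suc k) (suc i)
  rewrite coeff-step-suc (JS n k) (+ (suc k ℕ.* suc k)) (+ suc k) (JS n (suc k)) i
        | coeff-JS n k (suc i) | coeff-JS n (suc k) (suc i) | coeff-JS n (suc k) i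
  = sym (pos-+-*-+-* (JSCoef.coef n k (suc i)) (suc k ℕ.* suc k) (JSCoef.coef n (suc k) (suc i))
                                                (suc k) (JSCoef.coef n (suc k) i))

S≡triangle : ∀ n k → S n k ≡ + triangle S-weight n k
S≡triangle zero    zero    = refl
S≡triangle zero    (suc k) = refl
S≡triangle (suc n) zero    = refl
S≡triangle (suc n) (suc k) rewrite S≡triangle n k | S≡triangle n (suc k) =
  sym (pos-+-* (triangle S-weight n k) (suc k) (triangle S-weight n (suc k)))

U≡triangle : ∀ n k → U n k ≡ + triangle U-weight n k
U≡triangle zero    zero    = refl
U≡triangle zero    (suc k) = refl
U≡triangle (suc n) zero    = refl
U≡triangle (suc n) (suc k) rewrite U≡triangle n k | U≡triangle n (suc k) =
  sym (pos-+-* (triangle U-weight n k) (suc k ℕ.* suc k)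
               (triangle U-weight n (suc k)))

sign : ℕ → ℤ
sign m = -1ℤ ^ m

module SignIdentities where
  open +-*-Solver

  signed-step : ∀ σ τ a b c →
    σ * τ * a + - c * (σ * (-1ℤ * τ) * b) ≡ -1ℤ * σ * (-1ℤ * τ) * (a + c * b)
  signed-step = solve 5 (λ σ τ a b c →
    σ :* τ :* a :+ :- c :* (σ :* (con -1ℤ :* τ) :* b)
    := con -1ℤ :* σ :* (con -1ℤ :* τ) :* (a :+ c :* b)) refl

  signed-step₂ : ∀ σ τ a b₁ b₂ c₁ c₂ →
    σ * τ * a + (- c₁ * (σ * (-1ℤ * τ) * b₁) + - c₂ * (σ * (-1ℤ * τ) * b₂))
    ≡ -1ℤ * σ * (-1ℤ * τ) * (a + (c₁ * b₁ + c₂ * b₂))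
  signed-step₂ = solve 7 (λ σ τ a b₁ b₂ c₁ c₂ →
    σ :* τ :* a :+ (:- c₁ :* (σ :* (con -1ℤ :* τ) :* b₁) :+ :- c₂ :* (σ :* (con -1ℤ :* τ) :* b₂))
    := con -1ℤ :* σ :* (con -1ℤ :* τ) :* (a :+ (c₁ :* b₁ :+ c₂ :* b₂))) refl

  square-swap : ∀ σ τ → σ * (τ * σ * τ) ≡ τ * τ * (σ * σ)
  square-swap = solve 2 (λ σ τ → σ :* (τ :* σ :* τ) := τ :* τ :* (σ :* σ)) refl

  neg-square : ∀ σ → -1ℤ * σ * (-1ℤ * σ) ≡ σ * σ
  neg-square = solve 1 (λ σ → con -1ℤ :* σ :* (con -1ℤ :* σ) := σ :* σ) refl
open SignIdentities

∣sign∣ : ∀ m → ∣ sign m ∣ ≡ 1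
∣sign∣ zero    = refl
∣sign∣ (suc m) = trans (ℤ.abs-* -1ℤ (sign m)) (trans (ℕ.*-identityˡ _) (∣sign∣ m))

∣sign*sign*pos∣ : ∀ m l x → ∣ sign m * sign l * + x ∣ ≡ x
∣sign*sign*pos∣ m l x = begin
  ∣ sign m * sign l * + x ∣        ≡⟨ ℤ.abs-* (sign m * sign l) (+ x) ⟩
  ∣ sign m * sign l ∣ ℕ.* x        ≡⟨ cong (ℕ._* x) (ℤ.abs-* (sign m) (sign l)) ⟩
  ∣ sign m ∣ ℕ.* ∣ sign l ∣ ℕ.* x  ≡⟨ cong₂ (λ a b → a ℕ.* b ℕ.* x) (∣sign∣ m) (∣sign∣ l) ⟩
  1 ℕ.* 1 ℕ.* x                    ≡⟨ ℕ.*-identityˡ x ⟩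
  x                                ∎
  where open ≡-Reasoning

sign-square : ∀ m → sign m * sign m ≡ 1ℤ
sign-square zero    = refl
sign-square (suc m) = trans (neg-square (sign m)) (sign-square m)

sign-cancel : ∀ k d → sign d * (sign (k ℕ.+ d) * sign k) ≡ 1ℤ
sign-cancel k d = begin
  sign d * (sign (k ℕ.+ d) * sign k)  ≡⟨ cong (λ t → sign d * (t * sign k)) (ℤ.^-distribˡ-+-* -1ℤ k d) ⟩
  sign d * (sign k * sign d * sign k) ≡⟨ square-swap (sign d) (sign k) ⟩
  sign k * sign k * (sign d * sign d) ≡⟨ cong₂ _*_ (sign-square k) (sign-square d) ⟩
  1ℤ                                  ∎
  where open ≡-Reasoning

module jsCoef = LinearTriangle u-weight s-weight

coeff-js : ∀ n k i → coeff (js n k) i ≡ sign n * sign k * + jsCoef.coef n k i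
coeff-js zero    zero    zero    = refl
coeff-js zero    zero    (suc i) = refl
coeff-js zero    (suc k) i       = sym (ℤ.*-zeroʳ (sign zero * sign (suc k)))
coeff-js (suc n) zero    i       = sym (ℤ.*-zeroʳ (sign (suc n) * sign zero))
coeff-js (suc n) (suc k) zero
  rewrite coeff-step-zero (js n k) (- (+ (n ℕ.* n))) (- (+ n)) (js n (suc k))
        | coeff-js n k 0 | coeff-js n (suc k) 0
  = trans (signed-step (sign n) (sign k) (+ a) (+ b) (+ (n ℕ.* n)))
          (cong (sign (suc n) * sign (suc k) *_) (sym (pos-+-* a (n ℕ.* n) b)))
  where a b : ℕ
        a = jsCoef.coef n k 0
        b = jsCoef.coef n (suc k) 0
coeff-js (suc n) (suc k) (suc i)
  rewrite coeff-step-suc (js n k) (- (+ (n ℕ.* n))) (- (+ n)) (js n (suc k)) i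
        | coeff-js n k (suc i) | coeff-js n (suc k) (suc i) | coeff-js n (suc k) i
  = trans (signed-step₂ (sign n) (sign k) (+ a) (+ b₁) (+ b₂) (+ (n ℕ.* n)) (+ n))
          (cong (sign (suc n) * sign (suc k) *_) (sym (pos-+-*-+-* a (n ℕ.* n) b₁ n b₂)))
  where a b₁ b₂ : ℕ
        a  = jsCoef.coef n k (suc i)
        b₁ = jsCoef.coef n (suc k) (suc i)
        b₂ = jsCoef.coef n (suc k) i

s≡signed-triangle : ∀ n k → s n k ≡ sign n * sign k * + triangle s-weight n k
s≡signed-triangle zero    zero    = refl
s≡signed-triangle zero    (suc k) = sym (ℤ.*-zeroʳ (sign zero * sign (suc k)))
s≡signed-triangle (suc n) zero    = sym (ℤ.*-zeroʳ (sign (suc n) * sign zero))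
s≡signed-triangle (suc n) (suc k)
  rewrite s≡signed-triangle n k | s≡signed-triangle n (suc k)
  = trans (signed-step (sign n) (sign k) (+ a) (+ b) (+ n))
          (cong (sign (suc n) * sign (suc k) *_) (sym (pos-+-* a n b)))
  where a b : ℕ
        a = triangle s-weight n k
        b = triangle s-weight n (suc k)

u≡signed-triangle : ∀ n k → u n k ≡ sign n * sign k * + triangle u-weight n k
u≡signed-triangle zero    zero    = refl
u≡signed-triangle zero    (suc k) = sym (ℤ.*-zeroʳ (sign zero * sign (suc k)))
u≡signed-triangle (suc n) zero    = sym (ℤ.*-zeroʳ (sign (suc n) * sign zero))
u≡signed-triangle (suc n) (suc k)
  rewrite u≡signed-triangle n k | u≡signed-triangle n (suc k)
  = trans (signed-step (sign n) (sign k) (+ a) (+ b) (+ (n ℕ.* n)))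
          (cong (sign (suc n) * sign (suc k) *_) (sym (pos-+-* a (n ℕ.* n) b)))
  where a b : ℕ
        a = triangle u-weight n k
        b = triangle u-weight n (suc k)

∣s∣≡triangle : ∀ n k → ∣ s n k ∣ ≡ triangle s-weight n k
∣s∣≡triangle n k = trans (cong ∣_∣ (s≡signed-triangle n k)) (∣sign*sign*pos∣ n k _)

∣u∣≡triangle : ∀ n k → ∣ u n k ∣ ≡ triangle u-weight n k
∣u∣≡triangle n k = trans (cong ∣_∣ (u≡signed-triangle n k)) (∣sign*sign*pos∣ n k _)

coeff-signed-js : ∀ {n k} i → k ≤ n → coeff (scale (sign (n ∸ k)) (js n k)) i ≡ + jsCoef.coef n k i
coeff-signed-js {n} {k} i k≤n = begin
  coeff (scale (sign d) (js n k)) i    ≡⟨ coeff-scale (sign d) (js n k) i ⟩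
  sign d * coeff (js n k) i            ≡⟨ cong (sign d *_) (coeff-js n k i) ⟩
  sign d * (sign n * sign k * + c)     ≡⟨ sym (ℤ.*-assoc (sign d) (sign n * sign k) (+ c)) ⟩
  sign d * (sign n * sign k) * + c     ≡⟨ cong (λ m → sign d * (sign m * sign k) * + c) (sym k+d≡n) ⟩
  sign d * (sign (k ℕ.+ d) * sign k) * + c ≡⟨ cong (_* + c) (sign-cancel k d) ⟩
  1ℤ * + c                             ≡⟨ ℤ.*-identityˡ (+ c) ⟩
  + c                                  ∎
  where
  open ≡-Reasoning
  d : ℕ
  d = n ∸ k
  c : ℕ
  c = jsCoef.coef n k i
  k+d≡n : k ℕ.+ d ≡ n
  k+d≡n = ℕ.m+[n∸m]≡n k≤n

theorem1 : (n k : ℕ) → 1 ≤ k → k ≤ n →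
    let A = JS n k
        B = scale ((- (+ 1)) ^ (n ∸ k)) (js n k)
    in ((i : ℕ) → i ≤ n ∸ k → + 0 <ℤ coeff A i)
       × ((i : ℕ) → n ∸ k < i → coeff A i ≡ + 0)
       × ((i : ℕ) → i ≤ n ∸ k → + 0 <ℤ coeff B i)
       × ((i : ℕ) → n ∸ k < i → coeff B i ≡ + 0)
       × coeff A (n ∸ k) ≡ S n k
       × coeff A 0 ≡ U n k
       × coeff B (n ∸ k) ≡ + ∣ s n k ∣
       × coeff B 0 ≡ + ∣ u n k ∣
theorem1 n k 1≤k k≤n =
    (λ i i≤d → subst (+ 0 <ℤ_) (sym (coeff-JS n k i))
                 (+<+ (JSCoef.coef-positive (λ _ → s≤s z≤n) (λ _ → s≤s z≤n) k i 1≤k (k+i≤n i≤d))))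
  , (λ i d<i → trans (coeff-JS n k i) (cong +_ (JSCoef.coef-vanishes k i (n<k+i d<i))))
  , (λ i i≤d → subst (+ 0 <ℤ_) (sym (coeff-signed-js i k≤n))
                 (+<+ (jsCoef.coef-positive (λ _ → s≤s z≤n) (λ _ → s≤s z≤n) k i 1≤k (k+i≤n i≤d))))
  , (λ i d<i → trans (coeff-signed-js i k≤n) (cong +_ (jsCoef.coef-vanishes k i (n<k+i d<i))))
  , trans (coeff-JS n k (n ∸ k))
          (trans (cong +_ (JSCoef.coef-leading k (n ∸ k) k+d≡n)) (sym (S≡triangle n k)))
  , trans (coeff-JS n k 0) (trans (cong +_ (JSCoef.coef-constant n k)) (sym (U≡triangle n k)))
  , trans (coeff-signed-js (n ∸ k) k≤n)
          (cong +_ (trans (jsCoef.coef-leading k (n ∸ k) k+d≡n) (sym (∣s∣≡triangle n k))))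
  , trans (coeff-signed-js 0 k≤n) (cong +_ (trans (jsCoef.coef-constant n k) (sym (∣u∣≡triangle n k))))
  where
  k+d≡n : k ℕ.+ (n ∸ k) ≡ n
  k+d≡n = ℕ.m+[n∸m]≡n k≤n
  k+i≤n : ∀ {i} → i ≤ n ∸ k → k ℕ.+ i ≤ n
  k+i≤n i≤d = ℕ.≤-trans (ℕ.+-monoʳ-≤ k i≤d) (ℕ.≤-reflexive k+d≡n)
  n<k+i : ∀ {i} → n ∸ k < i → n < k ℕ.+ i
  n<k+i d<i = ℕ.≤-<-trans (ℕ.m≤n+m∸n n k) (ℕ.+-monoʳ-< k d<i)
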